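{- There is $N_0$ such that for all integers $N\ge N_0$ the following holds. Let $r,d$ be positive integers with $\gcd(d,r)=1$, let $\Pi=r(r+d)\cdots(r+(N-1)d)$, and for every prime $p$ dividing $\Pi$ select one term $r+id$ ($0\le i\le N-1$) for which $\mathrm{ord}_p(r+id)$ is maximal among all terms (ties resolved arbitrarily); let $M$ be the number of distinct terms selected in this way. Then either both $d<N^2$ and $r<N^2$, or $M>N/2$.
   Context: For a prime $p$ and a nonzero integer $m$, $\mathrm{ord}_p(m)$ is the largest integer $e$ with $p^e\mid m$. -}

module Defs where

open import Data.Nat using (ℕ; suc; _+_; _*_; _^_; _≤_; _<_; _≟_)
open import Data.Nat.Divisibility using (_∣_; _∣?_)
open import Data.Nat.Primality using (Prime; prime?)
open import Data.Bool using (Bool; _∧_)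
open import Data.List using (List; map; upTo; filterᵇ; length)
open import Data.Nat.ListAction using (product)
open import Data.Bool.ListAction using (any)
open import Data.Product using (_×_)
open import Relation.Nullary using (¬_; ⌊_⌋)

term : ℕ → ℕ → ℕ → ℕ
term r d i = r + i * d

Πprod : ℕ → ℕ → ℕ → ℕ
Πprod r d N = product (map (term r d) (upTo N))

IsOrd : ℕ → ℕ → ℕ → Set
IsOrd p m e = (p ^ e ∣ m) × ¬ (p ^ suc e ∣ m)

IsSelection : ℕ → ℕ → ℕ → (ℕ → ℕ) → Set
IsSelection r d N sel =
  ∀ p → Prime p → p ∣ Πprod r d N →
    (sel p < N) ×
    (∀ j → j < N → ∀ e e′ → IsOrd p (term r d j) e → IsOrd p (term r d (sel p)) e′ → e ≤ e′)

-- index i is selected by some prime p ∣ Π (primes dividing Π > 0 are ≤ Π)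
selectedᵇ : ℕ → ℕ → ℕ → (ℕ → ℕ) → ℕ → Bool
selectedᵇ r d N sel i =
  any (λ p → ⌊ prime? p ⌋ ∧ ⌊ p ∣? Πprod r d N ⌋ ∧ ⌊ sel p ≟ i ⌋) (upTo (suc (Πprod r d N)))

-- M = number of distinct selected terms (terms are distinct since d ≥ 1, so count indices)
Mcount : ℕ → ℕ → ℕ → (ℕ → ℕ) → ℕ
Mcount r d N sel = length (filterᵇ (selectedᵇ r d N sel) (upTo N))

-- Write a i = r + i d, Π = ∏_{i<N} a i, and let S be the set of indices i < N
-- not selected by any prime; P_S = ∏_{i∈S} a i.  The heart of the proof is
--
--     P_S ∣ (N - 1)!.
--
-- Fix a prime q and put m = sel q.  For i ∈ S we have i ≠ m, and by maximality
-- of ord_q(a m) every power of q dividing a i divides a m, hence divides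
-- ∣ a i - a m ∣ = d ∣ i - m ∣; as gcd(d , r) = 1 the prime q does not divide d,
-- so the power divides ∣ i - m ∣.  Powers of a prime dividing a product split
-- among the factors, so every power of q dividing P_S divides
-- ∏_{i∈S} ∣ i - m ∣, which divides ∏_{i<N, i≠m} ∣ i - m ∣ = m! (N-1-m)! and
-- hence (N-1)!.  A number all of whose prime-power divisors divide Y divides Y.
--
-- If d ≥ N² or r ≥ N², all a i with i ≥ 1 are at least N², so P_S ≥ N^(2(|S|-1)).
-- When M ≤ N/2 we have |S| ≥ N/2, giving N^(N-2) ≤ P_S ≤ (N-1)! < N^(N-2) for
-- N ≥ 3, a contradiction.  Hence N₀ = 3 works.
module Submission where

open import Defs
open import Data.Nat using (ℕ; _*_; _≤_; _<_; _^_)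
open import Data.Nat.GCD using (gcd)
open import Data.Product using (Σ; _×_)
open import Data.Sum using (_⊎_)
open import Relation.Binary.PropositionalEquality using (_≡_)

open import Data.Nat
open import Data.Nat.Properties
open import Data.Nat.Divisibility
open import Data.Nat.Primality
open import Data.Nat.GCD using (gcd-greatest)
open import Data.Nat.Induction using (<-rec)
open import Data.Nat.Combinatorics using (k![n∸k]!∣n!)
open import Data.Nat.ListAction using (product)
open import Data.Nat.ListAction.Properties using (product-++)
open import Data.Bool using (Bool; true; false; not; T; _∧_)
open import Data.Bool.Properties using (T-∧)
open import Data.List using (List; []; _∷_; map; filterᵇ; length; upTo; applyUpTo; _++_; [_])
open import Data.List.Properties using (upTo-∷ʳ; map-++; length-upTo)
open import Data.List.Membership.Propositional using (_∈_; lose)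
open import Data.List.Membership.Propositional.Properties using (∈-upTo⁺; ∈-upTo⁻; ∈-filter⁻)
open import Data.List.Relation.Unary.All as All using (All; []; _∷_)
open import Data.List.Relation.Unary.All.Properties using (applyUpTo⁺₂; filter⁺)
open import Data.List.Relation.Unary.Any.Properties using (any⁺)
open import Data.Product using (∃; ∃₂; _,_; proj₁; proj₂)
open import Data.Sum using (inj₁; inj₂)
open import Data.Empty using (⊥-elim)
open import Function.Base using (_∘_)
open import Function.Bundles using (Equivalence)
open import Relation.Nullary using (¬_; yes; no; ⌊_⌋)
open import Relation.Nullary.Decidable using (fromWitness; T?)
open import Relation.Binary.PropositionalEquality
  using (_≢_; refl; sym; trans; cong; cong₂; subst; module ≡-Reasoning)

^-∣-^ : ∀ p {e f} → e ≤ f → p ^ e ∣ p ^ f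
^-∣-^ p {e} {f} e≤f = divides (p ^ (f ∸ e)) (begin
  p ^ f               ≡⟨ cong (p ^_) (m∸n+n≡m e≤f) ⟨
  p ^ (f ∸ e + e)     ≡⟨ ^-distribˡ-+-* p (f ∸ e) e ⟩
  p ^ (f ∸ e) * p ^ e ∎)
  where open ≡-Reasoning

prime∤prime : ∀ {p q} → Prime q → Prime p → q ≢ p → ¬ q ∣ p
prime∤prime {q = q} qp pp q≢p q∣p with prime⇒irreducible pp q∣p
... | inj₁ q≡1 = nonTrivial⇒≢1 {{prime⇒nonTrivial qp}} q≡1
... | inj₂ q≡p = q≢p q≡p

prime-divisor : ∀ n → 1 < n → ∃ λ p → Prime p × p ∣ n
prime-divisor = <-rec (λ n → 1 < n → ∃ λ p → Prime p × p ∣ n) step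
  where
  step : ∀ n → (∀ {m} → m < n → 1 < m → ∃ λ p → Prime p × p ∣ m) →
         1 < n → ∃ λ p → Prime p × p ∣ n
  step n rec n>1 with composite? n
  ... | no ¬composite = n , prime {{n>1⇒nonTrivial n>1}} ¬composite , ∣-refl
  ... | yes (hasNonTrivialDivisor {m} m<n m∣n) with rec m<n (nonTrivial⇒n>1 m)
  ...   | p , pp , p∣m = p , pp , ∣-trans p∣m m∣n

module _ {p : ℕ} (pp : Prime p) where

  private instance
    p≢0 : NonZero p
    p≢0 = prime⇒nonZero pp

  prime-power-split : ∀ e x y → p ^ e ∣ x * y →
                      ∃₂ λ e₁ e₂ → e₁ + e₂ ≡ e × p ^ e₁ ∣ x × p ^ e₂ ∣ y
  prime-power-split zero x y _ = 0 , 0 , refl , 1∣ x , 1∣ y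
  prime-power-split (suc e) x y pᵉ⁺¹∣xy
    with euclidsLemma x y pp (m*n∣⇒m∣ p (p ^ e) pᵉ⁺¹∣xy)
  ... | inj₁ (divides x′ refl) =
    let e₁ , e₂ , eq , h₁ , h₂ = prime-power-split e x′ y
          (*-cancelˡ-∣ p (subst (p ^ suc e ∣_) (pull-p x′ y) pᵉ⁺¹∣xy))
    in suc e₁ , e₂ , cong suc eq , subst (p ^ suc e₁ ∣_) (*-comm p x′) (*-monoʳ-∣ p h₁) , h₂
    where
    pull-p : ∀ a b → a * p * b ≡ p * (a * b)
    pull-p a b = trans (cong (_* b) (*-comm a p)) (*-assoc p a b)
  ... | inj₂ (divides y′ refl) =
    let e₁ , e₂ , eq , h₁ , h₂ = prime-power-split e x y′
          (*-cancelˡ-∣ p (subst (p ^ suc e ∣_) (pull-p x y′) pᵉ⁺¹∣xy))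
    in e₁ , suc e₂ , trans (+-suc e₁ e₂) (cong suc eq) , h₁ ,
       subst (p ^ suc e₂ ∣_) (*-comm p y′) (*-monoʳ-∣ p h₂)
    where
    pull-p : ∀ a b → a * (b * p) ≡ p * (a * b)
    pull-p a b = trans (sym (*-assoc a b p)) (*-comm (a * b) p)

  prime-power-∣-cancel : ∀ {x y} e → ¬ p ∣ x → p ^ e ∣ x * y → p ^ e ∣ y
  prime-power-∣-cancel {x} {y} e p∤x pᵉ∣xy with prime-power-split e x y pᵉ∣xy
  ... | zero , _ , refl , _ , h₂ = h₂
  ... | suc e₁ , _ , _ , h₁ , _ = ⊥-elim (p∤x (m*n∣⇒m∣ p (p ^ e₁) h₁))

  -- If every power of p dividing f i divides g i (for i in L), the same holds
  -- for the products over L: the p-part of a product is the product of p-parts.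
  prime-power-∣-product : (f g : ℕ → ℕ) (L : List ℕ) →
    All (λ i → ∀ e → p ^ e ∣ f i → p ^ e ∣ g i) L →
    ∀ e → p ^ e ∣ product (map f L) → p ^ e ∣ product (map g L)
  prime-power-∣-product f g [] [] e pᵉ∣1 = pᵉ∣1
  prime-power-∣-product f g (i ∷ L) (fg ∷ fgs) e pᵉ∣∏
    with prime-power-split e (f i) (product (map f L)) pᵉ∣∏
  ... | e₁ , e₂ , refl , h₁ , h₂ =
    subst (_∣ g i * product (map g L)) (sym (^-distribˡ-+-* p e₁ e₂))
      (*-pres-∣ (fg e₁ h₁) (prime-power-∣-product f g L fgs e₂ h₂))

  ord-exists : ∀ x → 0 < x → ∃ (IsOrd p x)
  ord-exists = <-rec (λ x → 0 < x → ∃ (IsOrd p x)) step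
    where
    step : ∀ x → (∀ {y} → y < x → 0 < y → ∃ (IsOrd p y)) → 0 < x → ∃ (IsOrd p x)
    step x rec x>0 with p ∣? x
    ... | no p∤x = 0 , 1∣ x , λ p¹∣x → p∤x (m*n∣⇒m∣ p 1 p¹∣x)
    ... | yes (divides y refl) with rec y<yp (>-nonZero⁻¹ y {{y≢0}})
      where
      y≢0 : NonZero y
      y≢0 = m*n≢0⇒m≢0 y {{>-nonZero x>0}}
      y<yp : y < y * p
      y<yp = m<m*n y p {{y≢0}} (nonTrivial⇒n>1 p {{prime⇒nonTrivial pp}})
    ...   | e , pᵉ∣y , pᵉ⁺¹∤y =
      suc e , subst (p ^ suc e ∣_) (*-comm p y) (*-monoʳ-∣ p pᵉ∣y) ,
      λ pᵉ⁺²∣yp → pᵉ⁺¹∤y (*-cancelˡ-∣ p (subst (p ^ suc (suc e) ∣_) (*-comm y p) pᵉ⁺²∣yp))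

  ord-bound : ∀ {x e} k → IsOrd p x e → p ^ k ∣ x → k ≤ e
  ord-bound {x} {e} k (_ , pᵉ⁺¹∤x) pᵏ∣x with k ≤? e
  ... | yes k≤e = k≤e
  ... | no k≰e = ⊥-elim (pᵉ⁺¹∤x (∣-trans (^-∣-^ p (≰⇒> k≰e)) pᵏ∣x))

  ord-≤⇒power-∣ : ∀ {x y} k → 0 < x → 0 < y →
    (∀ e e′ → IsOrd p x e → IsOrd p y e′ → e ≤ e′) → p ^ k ∣ x → p ^ k ∣ y
  ord-≤⇒power-∣ {x} {y} k x>0 y>0 ord≤ pᵏ∣x
    with ord-exists x x>0 | ord-exists y y>0
  ... | e , ordx | e′ , ordy =
    ∣-trans (^-∣-^ p (≤-trans (ord-bound k ordx pᵏ∣x) (ord≤ e e′ ordx ordy))) (proj₁ ordy)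

-- X ∣ Y as soon as every prime power dividing X divides Y.  By strong
-- induction: write X = X′ p with p prime; then p ∣ Y, say Y = Y′ p, and the
-- hypothesis descends to the pair (X′, Y′).
prime-powers-∣ : ∀ X Y → 0 < X → (∀ q k → Prime q → q ^ k ∣ X → q ^ k ∣ Y) → X ∣ Y
prime-powers-∣ = <-rec (λ X → ∀ Y → 0 < X → Hyp X Y → X ∣ Y) step
  where
  Hyp : ℕ → ℕ → Set
  Hyp X Y = ∀ q k → Prime q → q ^ k ∣ X → q ^ k ∣ Y

  step : ∀ X → (∀ {X′} → X′ < X → ∀ Y → 0 < X′ → Hyp X′ Y → X′ ∣ Y) →
         ∀ Y → 0 < X → Hyp X Y → X ∣ Y
  step 1 rec Y _ H = 1∣ Y
  step X@(2+ _) rec Y X>0 H with prime-divisor X (s<s z<s)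
  ... | p , pp , divides X′ X≡X′p
    with subst (_∣ Y) (*-identityʳ p) (H p 1 pp (subst (_∣ X) (sym (*-identityʳ p)) (divides X′ X≡X′p)))
  ...   | divides Y′ refl =
    subst (_∣ Y′ * p) (sym X≡X′p) (*-monoˡ-∣ p (rec X′<X Y′ X′>0 H′))
    where
    instance
      p≢0 : NonZero p
      p≢0 = prime⇒nonZero pp
    X′≢0 : NonZero X′
    X′≢0 = m*n≢0⇒m≢0 X′ {{subst NonZero X≡X′p _}}
    X′>0 : 0 < X′
    X′>0 = >-nonZero⁻¹ X′ {{X′≢0}}
    X′<X : X′ < X
    X′<X = subst (X′ <_) (sym X≡X′p)
             (m<m*n X′ p {{X′≢0}} (nonTrivial⇒n>1 p {{prime⇒nonTrivial pp}}))
    H′ : Hyp X′ Y′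
    H′ q k qp qᵏ∣X′ with q ≟ p
    ... | yes refl = *-cancelʳ-∣ p (subst (_∣ Y′ * p) (*-comm p (p ^ k)) (H p (suc k) pp
                       (subst (p ^ suc k ∣_) (trans (*-comm p X′) (sym X≡X′p)) (*-monoʳ-∣ p qᵏ∣X′))))
    ... | no q≢p = prime-power-∣-cancel qp k (prime∤prime qp pp q≢p)
                     (subst (q ^ k ∣_) (*-comm Y′ p)
                       (H q k qp (subst (q ^ k ∣_) (sym X≡X′p) (∣m⇒∣m*n p qᵏ∣X′))))

product-upTo-suc : (f : ℕ → ℕ) (n : ℕ) →
  product (map f (upTo (suc n))) ≡ product (map f (upTo n)) * f n
product-upTo-suc f n = begin
  product (map f (upTo (suc n)))       ≡⟨ cong (λ l → product (map f l)) (upTo-∷ʳ n) ⟨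
  product (map f (upTo n ++ [ n ]))    ≡⟨ cong product (map-++ f (upTo n) [ n ]) ⟩
  product (map f (upTo n) ++ [ f n ])  ≡⟨ product-++ (map f (upTo n)) [ f n ] ⟩
  product (map f (upTo n)) * (f n * 1) ≡⟨ cong (product (map f (upTo n)) *_) (*-identityʳ (f n)) ⟩
  product (map f (upTo n)) * f n       ∎
  where open ≡-Reasoning

product-filter-∣ : (u : ℕ → Bool) (f : ℕ → ℕ) (L : List ℕ) →
  product (map f (filterᵇ u L)) ∣ product (map f L)
product-filter-∣ u f [] = ∣-refl
product-filter-∣ u f (i ∷ L) with u i
... | true  = *-monoʳ-∣ (f i) (product-filter-∣ u f L)
... | false = ∣n⇒∣m*n (f i) (product-filter-∣ u f L)

product-pos : (f : ℕ → ℕ) (L : List ℕ) → (∀ i → 0 < f i) → 0 < product (map f L)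
product-pos f []      _   = z<s
product-pos f (i ∷ L) f>0 = *-mono-< (f>0 i) (product-pos f L f>0)

product-≥-power : (f : ℕ → ℕ) (B : ℕ) (L : List ℕ) →
  All (λ i → B ≤ f i) L → B ^ length L ≤ product (map f L)
product-≥-power f B []      []         = ≤-refl
product-≥-power f B (i ∷ L) (B≤fi ∷ h) = *-mono-≤ B≤fi (product-≥-power f B L h)

product-filter-≥-power : (u : ℕ → Bool) (f : ℕ → ℕ) (B x : ℕ) (L : List ℕ) →
  1 ≤ B → 1 ≤ f x → All (λ i → B ≤ f i) L →
  B ^ (length (filterᵇ u (x ∷ L)) ∸ 1) ≤ product (map f (filterᵇ u (x ∷ L)))
product-filter-≥-power u f B x L B≥1 fx≥1 h with u x
... | true  = ≤-trans (product-≥-power f B (filterᵇ u L) (filter⁺ (T? ∘ u) h))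
                      (m≤n*m _ (f x) {{>-nonZero fx≥1}})
... | false = ≤-trans (^-monoʳ-≤ B {{>-nonZero B≥1}} (m∸n≤m (length (filterᵇ u L)) 1))
                      (product-≥-power f B (filterᵇ u L) (filter⁺ (T? ∘ u) h))

filtered-range-product-≥ : (u : ℕ → Bool) (f : ℕ → ℕ) (B n : ℕ) →
  1 ≤ B → 1 ≤ f 0 → (∀ i → 1 ≤ i → B ≤ f i) →
  B ^ (length (filterᵇ u (upTo n)) ∸ 1) ≤ product (map f (filterᵇ u (upTo n)))
filtered-range-product-≥ u f B zero    _   _    _   = ≤-refl
filtered-range-product-≥ u f B (suc n) B≥1 f0≥1 big = product-filter-≥-power u f B 0 (applyUpTo suc n)
  B≥1 f0≥1 (applyUpTo⁺₂ suc n (λ i → big (suc i) (s≤s z≤n)))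

length-filter-partition : (u : ℕ → Bool) (L : List ℕ) →
  length (filterᵇ u L) + length (filterᵇ (λ i → not (u i)) L) ≡ length L
length-filter-partition u [] = refl
length-filter-partition u (i ∷ L) with u i
... | true  = cong suc (length-filter-partition u L)
... | false = trans (+-suc _ _) (cong suc (length-filter-partition u L))

-- The gap product: ∏_{i<n, i≠m} ∣ i - m ∣.

gap : ℕ → ℕ → ℕ
gap m i with i ≟ m
... | yes _ = 1
... | no  _ = ∣ i - m ∣

gap-≢ : ∀ {m i} → i ≢ m → gap m i ≡ ∣ i - m ∣
gap-≢ {m} {i} i≢m with i ≟ m
... | yes i≡m = ⊥-elim (i≢m i≡m)
... | no  _   = refl

gap-≡ : ∀ m → gap m m ≡ 1
gap-≡ m with m ≟ m
... | yes _   = refl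
... | no  m≢m = ⊥-elim (m≢m refl)

gapProduct : ℕ → ℕ → ℕ
gapProduct m n = product (map (gap m) (upTo n))

-- Below m the gaps are m, m - 1, …, so they complete k! to (n + k)!.
gapProduct-below : ∀ n k → gapProduct (n + k) n * k ! ≡ (n + k) !
gapProduct-below zero    k = +-identityʳ (k !)
gapProduct-below (suc n) k = begin
  gapProduct (suc n + k) (suc n) * k !           ≡⟨ cong (λ m → gapProduct m (suc n) * k !) (+-suc n k) ⟨
  gapProduct m (suc n) * k !                     ≡⟨ cong (_* k !) (product-upTo-suc (gap m) n) ⟩
  gapProduct m n * gap m n * k !                 ≡⟨ cong (λ g → gapProduct m n * g * k !) gap-n ⟩
  gapProduct m n * suc k * k !                   ≡⟨ *-assoc (gapProduct m n) (suc k) (k !) ⟩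
  gapProduct m n * suc k !                       ≡⟨ gapProduct-below n (suc k) ⟩
  m !                                            ≡⟨ cong _! (+-suc n k) ⟩
  (suc n + k) !                                  ∎
  where
  open ≡-Reasoning
  m = n + suc k
  gap-n : gap m n ≡ suc k
  gap-n = trans (gap-≢ (λ n≡m → m≢1+m+n n (trans n≡m (+-suc n k)))) (∣m-m+n∣≡n n (suc k))

gapProduct-factorials : ∀ m t → gapProduct m (suc m + t) ≡ m ! * t !
gapProduct-factorials m zero = begin
  gapProduct m (suc m + 0)  ≡⟨ cong (gapProduct m) (+-identityʳ (suc m)) ⟩
  gapProduct m (suc m)      ≡⟨ product-upTo-suc (gap m) m ⟩
  gapProduct m m * gap m m  ≡⟨ cong (gapProduct m m *_) (gap-≡ m) ⟩
  gapProduct m m * 1        ≡⟨ cong (λ n → gapProduct n m * 1) (+-identityʳ m) ⟨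
  gapProduct (m + 0) m * 1  ≡⟨ gapProduct-below m 0 ⟩
  (m + 0) !                 ≡⟨ cong _! (+-identityʳ m) ⟩
  m !                       ≡⟨ *-identityʳ (m !) ⟨
  m ! * 1                   ∎
  where open ≡-Reasoning
gapProduct-factorials m (suc t) = begin
  gapProduct m (suc m + suc t)              ≡⟨ cong (gapProduct m) (+-suc (suc m) t) ⟩
  gapProduct m (suc (suc m + t))            ≡⟨ product-upTo-suc (gap m) (suc m + t) ⟩
  gapProduct m (suc m + t) * gap m (suc m + t) ≡⟨ cong₂ _*_ (gapProduct-factorials m t) gap-top ⟩
  m ! * t ! * suc t                         ≡⟨ *-assoc (m !) (t !) (suc t) ⟩
  m ! * (t ! * suc t)                       ≡⟨ cong (m ! *_) (*-comm (t !) (suc t)) ⟩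
  m ! * suc t !                             ∎
  where
  open ≡-Reasoning
  gap-top : gap m (suc m + t) ≡ suc t
  gap-top = begin
    gap m (suc m + t)    ≡⟨ gap-≢ (m≢1+m+n m ∘ sym) ⟩
    ∣ suc m + t - m ∣    ≡⟨ cong (∣_- m ∣) (+-suc m t) ⟨
    ∣ m + suc t - m ∣    ≡⟨ ∣-∣-comm (m + suc t) m ⟩
    ∣ m - m + suc t ∣    ≡⟨ ∣m-m+n∣≡n m (suc t) ⟩
    suc t                ∎

gapProduct-∣-factorial : ∀ {m N} → m < N → gapProduct m N ∣ (N ∸ 1) !
gapProduct-∣-factorial {m} {N} m<N = subst (λ n → gapProduct m n ∣ (n ∸ 1) !) (m+[n∸m]≡n m<N)
  (subst (_∣ (m + t) !) (sym binomial) (k![n∸k]!∣n! (m≤m+n m t)))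
  where
  t = N ∸ suc m
  binomial : gapProduct m (suc m + t) ≡ m ! * (m + t ∸ m) !
  binomial = trans (gapProduct-factorials m t) (cong (λ n → m ! * n !) (sym (m+n∸m≡n m t)))

∣-∣-distance : ∀ {k x y} → k ∣ x → k ∣ y → k ∣ ∣ x - y ∣
∣-∣-distance {k} {x} {y} k∣x k∣y with ≤-total x y
... | inj₁ x≤y = subst (k ∣_) (sym (m≤n⇒∣m-n∣≡n∸m x≤y))
                   (∣m+n∣m⇒∣n (subst (k ∣_) (sym (m+[n∸m]≡n x≤y)) k∣y) k∣x)
... | inj₂ y≤x = subst (k ∣_) (sym (m≤n⇒∣n-m∣≡n∸m y≤x))
                   (∣m+n∣m⇒∣n (subst (k ∣_) (sym (m+[n∸m]≡n y≤x)) k∣x) k∣y)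

term-distance : ∀ r d i j → ∣ term r d i - term r d j ∣ ≡ d * ∣ i - j ∣
term-distance r d i j = begin
  ∣ r + i * d - r + j * d ∣  ≡⟨ ∣m+n-m+o∣≡∣n-o∣ r (i * d) (j * d) ⟩
  ∣ i * d - j * d ∣          ≡⟨ *-distribʳ-∣-∣ d i j ⟨
  ∣ i - j ∣ * d              ≡⟨ *-comm ∣ i - j ∣ d ⟩
  d * ∣ i - j ∣              ∎
  where open ≡-Reasoning

prime∣term⇒∤d : ∀ {r d q} i → gcd d r ≡ 1 → Prime q → q ∣ term r d i → ¬ q ∣ d
prime∣term⇒∤d {r} {d} {q} i coprime qp q∣term q∣d =
  nonTrivial⇒≢1 {{prime⇒nonTrivial qp}} (∣1⇒≡1 (subst (q ∣_) coprime (gcd-greatest q∣d q∣r)))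
  where
  q∣r : q ∣ r
  q∣r = ∣m+n∣m⇒∣n (subst (q ∣_) (+-comm r (i * d)) q∣term) (∣n⇒∣m*n i q∣d)

term-≥-r : ∀ r d i → r ≤ term r d i
term-≥-r r d i = m≤m+n r (i * d)

term-≥-d : ∀ r d i → 1 ≤ i → d ≤ term r d i
term-≥-d r d i i≥1 = ≤-trans (m≤n*m d i {{>-nonZero i≥1}}) (m≤n+m (i * d) r)

T-not⇒¬T : ∀ {b} → T (not b) → ¬ T b
T-not⇒¬T {false} _ ()

module UnselectedProduct (r d N : ℕ) (sel : ℕ → ℕ) (r≥1 : 1 ≤ r)
                         (coprime : gcd d r ≡ 1) (isSel : IsSelection r d N sel) where

  a : ℕ → ℕ
  a = term r d

  Π : ℕ
  Π = Πprod r d N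

  selected : ℕ → Bool
  selected = selectedᵇ r d N sel

  unselected : List ℕ
  unselected = filterᵇ (λ i → not (selected i)) (upTo N)

  unselectedProduct : ℕ
  unselectedProduct = product (map a unselected)

  a>0 : ∀ i → 0 < a i
  a>0 i = ≤-trans r≥1 (term-≥-r r d i)

  sel-selected : ∀ {q} → Prime q → q ∣ Π → T (selected (sel q))
  sel-selected {q} qp q∣Π = any⁺ (chooses (sel q)) (lose q∈range chosen)
    where
    q∈range : q ∈ upTo (suc Π)
    q∈range = ∈-upTo⁺ (s≤s (∣⇒≤ {{>-nonZero (product-pos a (upTo N) a>0)}} q∣Π))
    chooses : ℕ → ℕ → Bool
    chooses i p = ⌊ prime? p ⌋ ∧ ⌊ p ∣? Π ⌋ ∧ ⌊ sel p ≟ i ⌋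
    chosen : T (chooses (sel q) q)
    chosen = Equivalence.from T-∧ (fromWitness {a? = prime? q} qp ,
      Equivalence.from T-∧ (fromWitness {a? = q ∣? Π} q∣Π , fromWitness {a? = sel q ≟ sel q} refl))

  ∈-unselected : ∀ {i} → i ∈ unselected → i < N × ¬ T (selected i)
  ∈-unselected i∈S with ∈-filter⁻ (T? ∘ (λ i → not (selected i))) i∈S
  ... | i∈range , unsel = ∈-upTo⁻ i∈range , T-not⇒¬T unsel

  -- For a prime q ∣ Π and an unselected index i, every power of q dividing
  -- a i divides ∣ i - sel q ∣: it divides a (sel q) by maximality, hence the
  -- distance d ∣ i - sel q ∣, and q ∤ d.
  unselected-power-∣-gap : ∀ {q} → Prime q → q ∣ Π → ∀ {i} → i ∈ unselected →
                           ∀ e → q ^ e ∣ a i → q ^ e ∣ gap (sel q) i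
  unselected-power-∣-gap qp q∣Π i∈S zero _ = 1∣ _
  unselected-power-∣-gap {q} qp q∣Π {i} i∈S (suc e) qᵉ⁺¹∣ai =
    subst (q ^ suc e ∣_) (sym (gap-≢ i≢m)) qᵉ⁺¹∣∣i-m∣
    where
    m = sel q
    i<N = proj₁ (∈-unselected i∈S)
    i≢m : i ≢ m
    i≢m i≡m = proj₂ (∈-unselected i∈S) (subst (T ∘ selected) (sym i≡m) (sel-selected qp q∣Π))
    qᵉ⁺¹∣am : q ^ suc e ∣ a m
    qᵉ⁺¹∣am = ord-≤⇒power-∣ qp (suc e) (a>0 i) (a>0 m) (proj₂ (isSel q qp q∣Π) i i<N) qᵉ⁺¹∣ai
    q∤d : ¬ q ∣ d
    q∤d = prime∣term⇒∤d i coprime qp (m*n∣⇒m∣ q (q ^ e) qᵉ⁺¹∣ai)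
    qᵉ⁺¹∣∣i-m∣ : q ^ suc e ∣ ∣ i - m ∣
    qᵉ⁺¹∣∣i-m∣ = prime-power-∣-cancel qp (suc e) q∤d
      (subst (q ^ suc e ∣_) (term-distance r d i m) (∣-∣-distance qᵉ⁺¹∣ai qᵉ⁺¹∣am))

  unselected-product-∣-factorial : unselectedProduct ∣ (N ∸ 1) !
  unselected-product-∣-factorial =
    prime-powers-∣ _ _ (product-pos a unselected a>0) prime-power-∣
    where
    prime-power-∣ : ∀ q k → Prime q → q ^ k ∣ unselectedProduct → q ^ k ∣ (N ∸ 1) !
    prime-power-∣ q zero    _  _ = 1∣ _
    prime-power-∣ q (suc k) qp qᵏ⁺¹∣P =
      ∣-trans to-gaps (∣-trans (product-filter-∣ _ (gap m) (upTo N)) (gapProduct-∣-factorial m<N))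
      where
      q∣Π : q ∣ Π
      q∣Π = ∣-trans (m*n∣⇒m∣ q (q ^ k) qᵏ⁺¹∣P) (product-filter-∣ _ a (upTo N))
      m = sel q
      m<N = proj₁ (isSel q qp q∣Π)
      to-gaps : q ^ suc k ∣ product (map (gap m) unselected)
      to-gaps = prime-power-∣-product qp a (gap m) unselected
                  (All.tabulate (unselected-power-∣-gap qp q∣Π)) (suc k) qᵏ⁺¹∣P

  selected+unselected : Mcount r d N sel + length unselected ≡ N
  selected+unselected =
    trans (length-filter-partition selected (upTo N)) (length-upTo N)

  unselected-product-≥ : ∀ B → 1 ≤ B → (∀ i → 1 ≤ i → B ≤ a i) →
                         B ^ (length unselected ∸ 1) ≤ unselectedProduct
  unselected-product-≥ B B≥1 big =
    filtered-range-product-≥ (λ i → not (selected i)) a B N B≥1 (a>0 0) big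

-- (k + 1)! ≤ (k + 1) ^ k, since each factor 2, …, k + 1 is at most k + 1.
factorial-≤-power : ∀ k → suc k ! ≤ suc k ^ k
factorial-≤-power zero    = ≤-refl
factorial-≤-power (suc k) =
  *-monoʳ-≤ (suc (suc k)) (≤-trans (factorial-≤-power k) (^-monoˡ-≤ k (n≤1+n (suc k))))

factorial<power : ∀ {N} → 3 ≤ N → (N ∸ 1) ! < N ^ (N ∸ 2)
factorial<power (s≤s (s≤s (s≤s {n = j} _))) =
  ≤-<-trans (factorial-≤-power (suc j)) (^-monoˡ-< (suc j) (n<1+n (suc (suc j))))

few-of-first-kind : ∀ M s → 2 * M ≤ M + s → M + s ∸ 2 ≤ 2 * (s ∸ 1)
few-of-first-kind M s 2M≤M+s = begin
  M + s ∸ 2        ≤⟨ ∸-monoˡ-≤ 2 (+-monoˡ-≤ s M≤s) ⟩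
  s + s ∸ 2        ≡⟨ cong (λ n → s + n ∸ 2) (+-identityʳ s) ⟨
  2 * s ∸ 2 * 1    ≡⟨ *-distribˡ-∸ 2 s 1 ⟨
  2 * (s ∸ 1)      ∎
  where
  open ≤-Reasoning
  M≤s : M ≤ s
  M≤s = +-cancelˡ-≤ M M s (subst (_≤ M + s) (cong (M +_) (+-identityʳ M)) 2M≤M+s)

-- If all terms past the first are at least N² (N ≥ 3), more than half of the
-- terms are selected: otherwise N ^ (N - 2) ≤ P_S ≤ (N - 1)! < N ^ (N - 2).
many-selected : ∀ {N r d sel} → 3 ≤ N → 1 ≤ r → gcd d r ≡ 1 → IsSelection r d N sel →
                (∀ i → 1 ≤ i → N ^ 2 ≤ term r d i) → N < 2 * Mcount r d N sel
many-selected {N} {r} {d} {sel} N≥3 r≥1 coprime isSel big with N <? 2 * Mcount r d N sel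
... | yes N<2M = N<2M
... | no  N≮2M = ⊥-elim (<-irrefl refl (begin-strict
  N ^ (N ∸ 2)            ≤⟨ ^-monoʳ-≤ N {{>-nonZero (≤-trans (s≤s z≤n) N≥3)}} exponent ⟩
  N ^ (2 * (s ∸ 1))      ≡⟨ ^-*-assoc N 2 (s ∸ 1) ⟨
  (N ^ 2) ^ (s ∸ 1)      ≤⟨ unselected-product-≥ (N ^ 2) N²≥1 big ⟩
  unselectedProduct      ≤⟨ ∣⇒≤ {{(N ∸ 1) !≢0}} unselected-product-∣-factorial ⟩
  (N ∸ 1) !              <⟨ factorial<power N≥3 ⟩
  N ^ (N ∸ 2)            ∎))
  where
  open UnselectedProduct r d N sel r≥1 coprime isSel
  open ≤-Reasoning
  M = Mcount r d N sel
  s = length unselected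
  N²≥1 : 1 ≤ N ^ 2
  N²≥1 = m^n>0 N {{>-nonZero (≤-trans (s≤s z≤n) N≥3)}} 2
  exponent : N ∸ 2 ≤ 2 * (s ∸ 1)
  exponent = subst (λ n → n ∸ 2 ≤ 2 * (s ∸ 1)) selected+unselected
    (few-of-first-kind M s (subst (2 * M ≤_) (sym selected+unselected) (≮⇒≥ N≮2M)))

dichotomy : ∀ N → 3 ≤ N → ∀ r d → 1 ≤ r → 1 ≤ d → gcd d r ≡ 1 →
  ∀ (sel : ℕ → ℕ) → IsSelection r d N sel →
  ((d < N ^ 2) × (r < N ^ 2)) ⊎ (N < 2 * Mcount r d N sel)
dichotomy N N≥3 r d r≥1 _ coprime sel isSel with d <? N ^ 2 | r <? N ^ 2
... | yes d<N² | yes r<N² = inj₁ (d<N² , r<N²)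
... | no  d≮N² | _        = inj₂ (many-selected N≥3 r≥1 coprime isSel
                                   (λ i i≥1 → ≤-trans (≮⇒≥ d≮N²) (term-≥-d r d i i≥1)))
... | yes _    | no r≮N²  = inj₂ (many-selected N≥3 r≥1 coprime isSel
                                   (λ i _ → ≤-trans (≮⇒≥ r≮N²) (term-≥-r r d i)))

corollary1 : Σ ℕ (λ N₀ → ∀ N → N₀ ≤ N → ∀ r d → 1 ≤ r → 1 ≤ d → gcd d r ≡ 1 →
    ∀ (sel : ℕ → ℕ) → IsSelection r d N sel →
    ((d < N ^ 2) × (r < N ^ 2)) ⊎ (N < 2 * Mcount r d N sel))
corollary1 = 3 , dichotomy
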